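{- In the setting below, for every update time $t\in[\kappa]$, $|B^{(t)}|\le 4|A^{(t)}|+1$.
   Context: Let $\epsilon\in(0,1/10)$, $T:=\lfloor(1/\epsilon)\log(1/\epsilon)\rfloor$, $K:=\lceil(8/\epsilon^2)\log(1/\epsilon)\rceil$. A dynamic graph $G$ on node set $V$, initially empty, undergoes updates $\sigma_1,\dots,\sigma_\kappa$, each inserting or deleting one edge; $G^{(t)}=(V,E^{(t)})$ is the graph after $t$ updates. For each unordered pair $e$ of nodes, randomness is fixed in advance: an index $j_e\in[\eta]$, a round $i_e\in[T+1]$ and a color sequence $c_e(1),\dots,c_e(K)$. At each time $t$, the edges with $j_e=j$ form subgraph $\mathcal{G}_j^{(t)}$, and each $\mathcal{G}^{(t)}_j$ receives a tentative coloring as follows (palettes $\mathcal{C}_j$ for different $j$ are disjoint): with $S_i^{(t)}$ the edges of $E^{(t)}$ with $i_e=i$, for $i=1,\dots,T$ in order, $P^{(t)}_i(u):=\mathcal{C}_j\setminus\{\tilde\chi^{(t)}(f): f \text{ in } \mathcal{G}_j^{(t)} \text{ incident on } u,\ i_f<i\}$, and each edge $e=(u,v)$ of $\mathcal{G}_j^{(t)}$ with $i_e=i$ gets $\tilde\chi^{(t)}(e):=c_e(\ell)$ for the smallest $\ell\in[K]$ with $c_e(\ell)\in P_i^{(t)}(u)\cap P_i^{(t)}(v)$, or $\bot$ if none; edges with $i_e=T+1$ get $\bot$. Set $\tilde\chi^{(t)}(e):=\bot$ for $e\notin E^{(t)}$. The failed set $F^{(t)}$ consists of the edges $e\in E^{(t)}$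 with $\tilde\chi^{(t)}(e)=\bot$ or with some edge $f\ne e$ of $E^{(t)}$ with $i_f=i_e$ sharing an endpoint with $e$ and $\tilde\chi^{(t)}(f)=\tilde\chi^{(t)}(e)$. Define $A^{(t)}:=\{e\in E^{(t-1)}\cup E^{(t)}: i_e\le T,\ \tilde\chi^{(t-1)}(e)\ne\tilde\chi^{(t)}(e)\}$ and $B^{(t)}:=F^{(t-1)}\oplus F^{(t)}$ (symmetric difference). -}

module Defs where

open import Data.Nat using (ℕ; zero; suc; _≡ᵇ_; _<ᵇ_; _≤ᵇ_; _<_; _+_; _∸_)
open import Data.Bool using (Bool; true; false; _∧_; _∨_; not; _xor_; if_then_else_)
open import Data.Fin using (Fin; toℕ)
import Data.Fin as F
open import Data.Product using (_×_; _,_)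
open import Data.List using (List; []; _∷_; allFin; cartesianProduct; take; foldl)
open import Data.Bool.ListAction using (any; all)
open import Data.Vec using (Vec; toList)
open import Data.Maybe using (Maybe; just; nothing; is-nothing)
open import Data.Unit using (⊤)
open import Relation.Binary.PropositionalEquality using (_≡_)
open import Relation.Nullary.Decidable using (⌊_⌋)

-- Nodes are Fin n. An (unordered) pair of nodes {u,v} with u ≠ v is
-- represented canonically by the ordered pair (u , v) with u < v.
Edge : ℕ → Set
Edge n = Fin n × Fin n

_==F_ : ∀ {n} → Fin n → Fin n → Bool
a ==F b = ⌊ a F.≟ b ⌋

_==E_ : ∀ {n} → Edge n → Edge n → Bool
(a , b) ==E (c , d) = (a ==F c) ∧ (b ==F d)

_==M_ : Maybe ℕ → Maybe ℕ → Bool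
nothing ==M nothing = true
just a  ==M just b  = a ≡ᵇ b
_       ==M _       = false

-- all node pairs (the graph only ever contains canonical pairs u < v)
allEdges : (n : ℕ) → List (Edge n)
allEdges n = cartesianProduct (allFin n) (allFin n)

incidentOn : ∀ {n} → Fin n → Edge n → Bool
incidentOn u (c , d) = (u ==F c) ∨ (u ==F d)

shareEndpoint : ∀ {n} → Edge n → Edge n → Bool
shareEndpoint (a , b) f = incidentOn a f ∨ incidentOn b f

count : ∀ {A : Set} → (A → Bool) → List A → ℕ
count p [] = 0
count p (x ∷ xs) = if p x then suc (count p xs) else count p xs

firstMatch : (ℕ → Bool) → List ℕ → Maybe ℕ
firstMatch p [] = nothing
firstMatch p (x ∷ xs) = if p x then just x else firstMatch p xs

Graph : ℕ → Set
Graph n = Edge n → Bool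

emptyGraph : ∀ {n} → Graph n
emptyGraph _ = false

data Update (n : ℕ) : Set where
  ins : Edge n → Update n
  del : Edge n → Update n

applyU : ∀ {n} → Graph n → Update n → Graph n
applyU G (ins e) f = if f ==E e then true  else G f
applyU G (del e) f = if f ==E e then false else G f

Valid : ∀ {n} → Graph n → List (Update n) → Set
Valid G [] = ⊤
Valid G (ins (u , v) ∷ us) =
  (toℕ u < toℕ v) × (G (u , v) ≡ false) × Valid (applyU G (ins (u , v))) us
Valid G (del e ∷ us) = (G e ≡ true) × Valid (applyU G (del e)) us

graphAt : ∀ {n} → List (Update n) → ℕ → Graph n
graphAt us t = foldl applyU emptyGraph (take t us)

-- Tentative coloring of a graph G, given the fixed randomness
--   C  : palettes C_j (as finite lists of colors ℕ)
--   jx : e ↦ j_e ,  ix : e ↦ i_e ,  cx : e ↦ (c_e(1),…,c_e(K))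

module Coloring {n η K : ℕ} (T : ℕ) (C : Fin η → List ℕ)
  (jx : Edge n → Fin η) (ix : Edge n → ℕ) (cx : Edge n → Vec ℕ K)
  (G : Graph n) where

  inPalette : Fin η → ℕ → Bool
  inPalette j c = any (λ c' → c ≡ᵇ c') (C j)

  -- col r e : tentative color of e taking into account rounds 1..r
  -- (edges of later rounds, and edges not in G, are ⊥ = nothing)
  col : ℕ → Edge n → Maybe ℕ
  col zero e = nothing
  col (suc r) (u , v) =
    if G (u , v) ∧ (ix (u , v) ≡ᵇ suc r)
    then firstMatch (λ c → avail (jx (u , v)) u c ∧ avail (jx (u , v)) v c)
                    (toList (cx (u , v)))
    else col r (u , v)
    where
    -- c ∈ P_{r+1}(w) = C_j ∖ { χ̃(f) : f ∈ G_j incident on w, i_f < r+1 }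
    avail : Fin η → Fin n → ℕ → Bool
    avail j w c = inPalette j c ∧
      all (λ f → not (G f ∧ (jx f ==F j) ∧ incidentOn w f ∧ (ix f <ᵇ suc r)
                      ∧ (col r f ==M just c)))
          (allEdges n)

  -- χ̃ : result after rounds 1..T (edges with i_e = T+1 get ⊥)
  χ : Edge n → Maybe ℕ
  χ = col T

  failed : Edge n → Bool
  failed e = G e ∧ (is-nothing (χ e) ∨
    any (λ f → G f ∧ not (f ==E e) ∧ (ix f ≡ᵇ ix e) ∧ shareEndpoint e f
               ∧ (χ f ==M χ e))
        (allEdges n))

module Changes {n η K : ℕ} (T : ℕ) (C : Fin η → List ℕ)
  (jx : Edge n → Fin η) (ix : Edge n → ℕ) (cx : Edge n → Vec ℕ K)
  (us : List (Update n)) (t : ℕ) where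

  private
    Gprev = graphAt us (t ∸ 1)
    Gnow  = graphAt us t
    module P = Coloring T C jx ix cx Gprev
    module N = Coloring T C jx ix cx Gnow

  sizeA : ℕ
  sizeA = count (λ e → (Gprev e ∨ Gnow e) ∧ (ix e ≤ᵇ T) ∧ not (P.χ e ==M N.χ e))
                (allEdges n)

  sizeB : ℕ
  sizeB = count (λ e → P.failed e xor N.failed e) (allEdges n)

-- Only two facts about tentative colourings are used: an edge is coloured only if it is
-- present and its round is at most T, and consecutive graphs differ in at most one edge.
-- Charge every edge g of B other than the updated one to an edge of A.  If g ∈ A, charge it
-- to itself.  Otherwise g is present on both sides with the same colour, so it fails on one
-- side only because of a conflicting edge f that no longer conflicts with it on the other
-- side; then f changed colour, so f ∈ A, and g is charged to f.  An edge f receives at most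
-- one charge per side and endpoint, since two such edges would conflict with each other on
-- both sides and fail on both; and f is not charged from both sides and by itself, since it
-- would then fail on both sides.  So f receives at most 4 charges.

module Submission where

open import Defs
open import Data.Bool using (Bool; true; false; T; not; _∧_; _∨_; _xor_)
import Data.Bool as Bool
open import Data.Bool.Properties using (T-∧; T-∨; T-≡)
open import Data.Bool.ListAction using (any)
open import Data.Fin using (Fin)
import Data.Fin as F
open import Data.List using (List; []; _∷_; foldl; take; length)
open import Data.Vec using (Vec)
open import Data.List.Membership.Propositional using (_∈_; _∉_)
open import Data.List.Membership.Propositional.Properties using (∈-cartesianProduct⁺; ∈-allFin)
open import Data.List.Relation.Unary.All as All using (All; []; _∷_)
open import Data.List.Relation.Unary.AllPairs using ([]; _∷_)
open import Data.List.Relation.Unary.Any as Any using (here; there; satisfied)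
open import Data.List.Relation.Unary.Any.Properties using (¬Any[]; any⁺; any⁻)
open import Data.List.Relation.Unary.Unique.Propositional using (Unique)
import Data.List.Relation.Unary.Unique.Propositional.Properties as Unique
open import Data.Maybe using (Maybe; just; nothing; is-nothing)
open import Data.Maybe.Properties using (just-injective)
import Data.Maybe.Properties as Maybe
open import Data.Nat using (ℕ; zero; suc; _≤_; _+_; _*_; z≤n; s≤s; _≡ᵇ_; _≤ᵇ_)
open import Data.Nat.Properties
open import Data.Product using (_×_; _,_; proj₁; proj₂; ∃-syntax)
import Data.Product as Product
open import Data.Product.Properties using () renaming (≡-dec to ×-≡-dec)
open import Data.Product.Properties using (×-≡,≡↔≡)
open import Data.Product.Function.NonDependent.Propositional using (_×-⇔_)
open import Data.Sum using (_⊎_; inj₁; inj₂)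
import Data.Sum as Sum
open import Data.Sum.Function.Propositional using (_⊎-⇔_)
open import Function using (_∘_; _⇔_; mk⇔; Equivalence)
open import Function.Construct.Composition using (_⇔-∘_)
open import Function.Construct.Identity using (⇔-id)
open import Function.Properties.Inverse using (↔⇒⇔)
open import Function.Related.TypeIsomorphisms using (¬-cong-⇔)
open import Level using (0ℓ)
open import Relation.Binary using (DecidableEquality)
open import Relation.Binary.PropositionalEquality
  using (_≡_; _≢_; refl; sym; trans; cong; subst; module ≡-Reasoning)
open import Relation.Nullary using (Dec; yes; no; does; ¬_; ¬?; _×-dec_; contradiction)
open import Relation.Nullary.Decidable using (T?; toWitness; fromWitness; toSum; decidable-stable)
import Relation.Nullary.Decidable as Dec
open import Relation.Unary using (Pred; Decidable; _⊆_; _∪_; _∩_; ∁)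
open import Relation.Unary.Properties using (_∪?_; _∩?_; ∁?)

open Equivalence using (to; from)

module _ {A : Set} where

  count-mono : {P Q : Pred A 0ℓ} (P? : Decidable P) (Q? : Decidable Q) → P ⊆ Q
    → ∀ xs → count (does ∘ P?) xs ≤ count (does ∘ Q?) xs
  count-mono P? Q? P⊆Q [] = z≤n
  count-mono P? Q? P⊆Q (x ∷ xs) with P? x | Q? x
  ... | yes p | yes _ = s≤s (count-mono P? Q? P⊆Q xs)
  ... | yes p | no ¬q = contradiction (P⊆Q p) ¬q
  ... | no _  | yes _ = m≤n⇒m≤1+n (count-mono P? Q? P⊆Q xs)
  ... | no _  | no _  = count-mono P? Q? P⊆Q xs

  count-∪ : {P Q : Pred A 0ℓ} (P? : Decidable P) (Q? : Decidable Q)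
    → ∀ xs → count (does ∘ (P? ∪? Q?)) xs ≤ count (does ∘ P?) xs + count (does ∘ Q?) xs
  count-∪ P? Q? [] = z≤n
  count-∪ P? Q? (x ∷ xs) with P? x | Q? x
  ... | yes _ | yes _ = s≤s (≤-trans (count-∪ P? Q? xs) (+-monoʳ-≤ _ (n≤1+n _)))
  ... | yes _ | no _  = s≤s (count-∪ P? Q? xs)
  ... | no _  | yes _ = ≤-trans (s≤s (count-∪ P? Q? xs)) (≤-reflexive (sym (+-suc _ _)))
  ... | no _  | no _  = count-∪ P? Q? xs

  count-≤-∪ : {P Q R : Pred A 0ℓ} (P? : Decidable P) (Q? : Decidable Q) (R? : Decidable R)
    → R ⊆ P ∪ Q → ∀ xs → count (does ∘ R?) xs ≤ count (does ∘ P?) xs + count (does ∘ Q?) xs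
  count-≤-∪ P? Q? R? R⊆P∪Q xs =
    ≤-trans (count-mono R? (P? ∪? Q?) R⊆P∪Q xs) (count-∪ P? Q? xs)

  count-≡0 : {P : Pred A 0ℓ} (P? : Decidable P)
    → ∀ {xs} → All (∁ P) xs → count (does ∘ P?) xs ≡ 0
  count-≡0 P? [] = refl
  count-≡0 P? {x ∷ _} (¬p ∷ ¬ps) with P? x
  ... | yes p = contradiction p ¬p
  ... | no _  = count-≡0 P? ¬ps

  count-≤1 : {P : Pred A 0ℓ} (P? : Decidable P) → (∀ {x y} → P x → P y → x ≡ y)
    → ∀ {xs} → Unique xs → count (does ∘ P?) xs ≤ 1
  count-≤1 P? unique [] = z≤n
  count-≤1 P? unique {x ∷ _} (x∉xs ∷ xs!) with P? x
  ... | yes p = s≤s (≤-reflexive (count-≡0 P? (All.map (λ x≢y → x≢y ∘ unique p) x∉xs)))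
  ... | no _  = count-≤1 P? unique xs!

module _ {A B : Set} {Q : Pred B 0ℓ} {R : B → Pred A 0ℓ}
  (Q? : Decidable Q) (R? : ∀ y → Decidable (R y))
  {k : ℕ} (xs : List A) (bounded : ∀ {y} → Q y → count (does ∘ R? y) xs ≤ k) where

  Charger : List B → A → Set
  Charger ys x = ∃[ y ] y ∈ ys × Q y × R y x

  private
    charger-in-tail : ∀ {y ys x} → ¬ (Q y × R y x) → Charger (y ∷ ys) x → Charger ys x
    charger-in-tail ¬here (_ , here refl , qr) = contradiction qr ¬here
    charger-in-tail _ (y , there y∈ys , qr) = y , y∈ys , qr

  count-≤-charged : {P : Pred A 0ℓ} (P? : Decidable P)
    → ∀ ys → (∀ {x} → P x → Charger ys x) → count (does ∘ P?) xs ≤ count (does ∘ Q?) ys * k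
  count-≤-charged P? [] charger =
    ≤-reflexive (count-≡0 P? {xs} (All.tabulate λ _ p → ¬Any[] (proj₁ (proj₂ (charger p)))))
  count-≤-charged P? (y ∷ ys) charger with Q? y
  ... | no ¬q = count-≤-charged P? ys (charger-in-tail (¬q ∘ proj₁) ∘ charger)
  ... | yes q = begin
    count (does ∘ P?) xs
      ≤⟨ count-≤-∪ (R? y) P∖R? P? (λ {x} p → Sum.map₂ (p ,_) (toSum (R? y x))) xs ⟩
    count (does ∘ R? y) xs + count (does ∘ P∖R?) xs
      ≤⟨ +-mono-≤ (bounded q)
           (count-≤-charged P∖R? ys λ (p , ¬r) → charger-in-tail (¬r ∘ proj₂) (charger p)) ⟩
    k + count (does ∘ Q?) ys * k ∎
    where
    open ≤-Reasoning
    P∖R? = P? ∩? ∁? (R? y)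

infixr 2 _∧-⇔_ _∨-⇔_

_∧-⇔_ : ∀ {a b} {A B : Set} → T a ⇔ A → T b ⇔ B → T (a ∧ b) ⇔ (A × B)
p ∧-⇔ q = (p ×-⇔ q) ⇔-∘ T-∧

_∨-⇔_ : ∀ {a b} {A B : Set} → T a ⇔ A → T b ⇔ B → T (a ∨ b) ⇔ (A ⊎ B)
p ∨-⇔ q = (p ⊎-⇔ q) ⇔-∘ T-∨

T-does : ∀ {A : Set} (a? : Dec A) → T (does a?) ⇔ A
T-does (yes a) = mk⇔ (λ _ → a) _
T-does (no ¬a) = mk⇔ (λ ()) ¬a

T-not : ∀ {b} → T (not b) ⇔ (¬ T b)
T-not {b} = T-does (¬? (T? b))

T-xor : ∀ {a b} → T (a xor b) → (T a × ¬ T b) ⊎ (¬ T a × T b)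
T-xor {true}  {false} _ = inj₁ (_ , λ ())
T-xor {false} {true}  _ = inj₂ ((λ ()) , _)

T-≡ᵇ : ∀ {m n} → T (m ≡ᵇ n) ⇔ m ≡ n
T-≡ᵇ {m} {n} = T-does (m ≟ n)

T-≤ᵇ : ∀ {m n} → T (m ≤ᵇ n) ⇔ m ≤ n
T-≤ᵇ {m} {n} = T-does (m ≤? n)

T-==M : ∀ {x y} → T (x ==M y) ⇔ x ≡ y
T-==M {nothing} {nothing} = mk⇔ (λ _ → refl) _
T-==M {just a}  {just b}  = mk⇔ (cong just ∘ to T-≡ᵇ) (from T-≡ᵇ ∘ just-injective)
T-==M {nothing} {just _}  = mk⇔ (λ ()) (λ ())
T-==M {just _}  {nothing} = mk⇔ (λ ()) (λ ())

T-is-nothing : ∀ {x : Maybe ℕ} → T (is-nothing x) ⇔ x ≡ nothing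
T-is-nothing {nothing} = mk⇔ (λ _ → refl) _
T-is-nothing {just _}  = mk⇔ (λ ()) (λ ())

T-any : ∀ {A : Set} {P : Pred A 0ℓ} {p : A → Bool} {xs} → (∀ x → x ∈ xs)
  → (∀ {x} → T (p x) ⇔ P x) → T (any p xs) ⇔ (∃[ x ] P x)
T-any {p = p} {xs} complete T-p = mk⇔
  (Product.map₂ (to T-p) ∘ satisfied ∘ any⁻ p xs)
  (λ (x , px) → any⁺ p (Any.map (λ { refl → from T-p px }) (complete x)))

module _ {n : ℕ} where

  T-==F : ∀ {a b : Fin n} → T (a ==F b) ⇔ a ≡ b
  T-==F {a} {b} = mk⇔ (toWitness {a? = a F.≟ b}) (fromWitness {a? = a F.≟ b})

  T-==E : ∀ {e f : Edge n} → T (e ==E f) ⇔ e ≡ f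
  T-==E = ↔⇒⇔ ×-≡,≡↔≡ ⇔-∘ (T-==F ∧-⇔ T-==F)

  Incident : Fin n → Edge n → Set
  Incident w e = w ≡ proj₁ e ⊎ w ≡ proj₂ e

  Adjacent : Edge n → Edge n → Set
  Adjacent e f = ∃[ w ] Incident w e × Incident w f

  T-incidentOn : ∀ {w e} → T (incidentOn w e) ⇔ Incident w e
  T-incidentOn = T-==F ∨-⇔ T-==F

  T-shareEndpoint : ∀ {e f} → T (shareEndpoint e f) ⇔ Adjacent e f
  T-shareEndpoint {u , v} {f} = mk⇔ at-endpoint endpoint ⇔-∘ (T-incidentOn ∨-⇔ T-incidentOn)
    where
    at-endpoint : Incident u f ⊎ Incident v f → Adjacent (u , v) f
    at-endpoint (inj₁ i) = u , inj₁ refl , i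
    at-endpoint (inj₂ i) = v , inj₂ refl , i
    endpoint : Adjacent (u , v) f → Incident u f ⊎ Incident v f
    endpoint (_ , inj₁ refl , i) = inj₁ i
    endpoint (_ , inj₂ refl , i) = inj₂ i

  _≟ₑ_ : DecidableEquality (Edge n)
  _≟ₑ_ = ×-≡-dec F._≟_ F._≟_

  allEdges-complete : ∀ e → e ∈ allEdges n
  allEdges-complete (a , b) = ∈-cartesianProduct⁺ (∈-allFin a) (∈-allFin b)

  allEdges-unique : Unique (allEdges n)
  allEdges-unique = Unique.cartesianProduct⁺ (Unique.allFin⁺ n) (Unique.allFin⁺ n)

module _ {n : ℕ} where

  DifferInAtMostOneEdge : Graph n → Graph n → Set
  DifferInAtMostOneEdge G G′ = ∀ {e f} → G e ≢ G′ e → G f ≢ G′ f → e ≡ f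

  updatedEdge : Update n → Edge n
  updatedEdge (ins e) = e
  updatedEdge (del e) = e

  applyU-changes-only-updatedEdge : ∀ G u {f} → G f ≢ applyU G u f → f ≡ updatedEdge u
  applyU-changes-only-updatedEdge G (ins e) {f} changed with f ==E e in f==e
  ... | true  = to T-==E (from T-≡ f==e)
  ... | false = contradiction refl changed
  applyU-changes-only-updatedEdge G (del e) {f} changed with f ==E e in f==e
  ... | true  = to T-==E (from T-≡ f==e)
  ... | false = contradiction refl changed

  applyU-differs-in-one-edge : ∀ G u → DifferInAtMostOneEdge G (applyU G u)
  applyU-differs-in-one-edge G u changedₑ changedf =
    trans (applyU-changes-only-updatedEdge G u changedₑ)
          (sym (applyU-changes-only-updatedEdge G u changedf))

  foldl-applyU-step-differs-in-one-edge : ∀ G us t →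
    DifferInAtMostOneEdge (foldl applyU G (take t us)) (foldl applyU G (take (suc t) us))
  foldl-applyU-step-differs-in-one-edge G []       zero    changed _ = contradiction refl changed
  foldl-applyU-step-differs-in-one-edge G []       (suc t) changed _ = contradiction refl changed
  foldl-applyU-step-differs-in-one-edge G (u ∷ us) zero    = applyU-differs-in-one-edge G u
  foldl-applyU-step-differs-in-one-edge G (u ∷ us) (suc t) =
    foldl-applyU-step-differs-in-one-edge (applyU G u) us t

module _ {n η K : ℕ} (rounds : ℕ) (C : Fin η → List ℕ)
  (jx : Edge n → Fin η) (ix : Edge n → ℕ) (cx : Edge n → Vec ℕ K) (G : Graph n) where

  open Coloring rounds C jx ix cx G

  col-supported : ∀ r e {c} → col r e ≡ just c → T (G e) × ix e ≤ r
  col-supported (suc r) e eq with G e ∧ (ix e ≡ᵇ suc r) in current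
  ... | true  = Product.map₂ (≤-reflexive ∘ to T-≡ᵇ) (to T-∧ (from T-≡ current))
  ... | false = Product.map₂ m≤n⇒m≤1+n (col-supported r e eq)

  χ-supported : ∀ e {c} → χ e ≡ just c → T (G e) × ix e ≤ rounds
  χ-supported = col-supported rounds

data Side : Set where
  before after : Side

other : Side → Side
other before = after
other after  = before

-- Flipped and Recoloured are the sets B and A of the paper; their Boolean definitions are
-- spelled out as in Changes, so that they agree with it definitionally.
module Recolouring {n : ℕ} (rounds : ℕ) (ix : Edge n → ℕ)
  (G : Side → Graph n) (χ : Side → Edge n → Maybe ℕ)
  (supported : ∀ s e {c} → χ s e ≡ just c → T (G s e) × ix e ≤ rounds) where

  conflictᵇ : Side → Edge n → Edge n → Bool
  conflictᵇ s e f = G s f ∧ not (f ==E e) ∧ (ix f ≡ᵇ ix e) ∧ shareEndpoint e f ∧ (χ s f ==M χ s e)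

  failedᵇ : Side → Edge n → Bool
  failedᵇ s e = G s e ∧ (is-nothing (χ s e) ∨ any (conflictᵇ s e) (allEdges n))

  Flipped : Pred (Edge n) 0ℓ
  Flipped e = T (failedᵇ before e xor failedᵇ after e)

  Recoloured : Pred (Edge n) 0ℓ
  Recoloured e = T ((G before e ∨ G after e) ∧ (ix e ≤ᵇ rounds) ∧ not (χ before e ==M χ after e))

  Flipped? : Decidable Flipped
  Flipped? e = T? _

  Recoloured? : Decidable Recoloured
  Recoloured? e = T? _

  Conflict : Side → Edge n → Edge n → Set
  Conflict s e f = T (G s f) × f ≢ e × ix f ≡ ix e × Adjacent e f × χ s f ≡ χ s e

  Failed : Side → Edge n → Set
  Failed s e = T (G s e) × (χ s e ≡ nothing ⊎ ∃[ f ] Conflict s e f)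

  T-conflictᵇ : ∀ {s e f} → T (conflictᵇ s e f) ⇔ Conflict s e f
  T-conflictᵇ =
    ⇔-id _ ∧-⇔ ¬-cong-⇔ T-==E ⇔-∘ T-not ∧-⇔ T-≡ᵇ ∧-⇔ T-shareEndpoint ∧-⇔ T-==M

  T-failedᵇ : ∀ {s e} → T (failedᵇ s e) ⇔ Failed s e
  T-failedᵇ = ⇔-id _ ∧-⇔ T-is-nothing ∨-⇔ T-any allEdges-complete T-conflictᵇ

  Conflict? : ∀ s e → Decidable (Conflict s e)
  Conflict? s e f = Dec.map T-conflictᵇ (T? _)

  T-recoloured : ∀ {e} → Recoloured e ⇔
    ((T (G before e) ⊎ T (G after e)) × ix e ≤ rounds × χ before e ≢ χ after e)
  T-recoloured = T-∨ ∧-⇔ T-≤ᵇ ∧-⇔ ¬-cong-⇔ T-==M ⇔-∘ T-not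

  recoloured : ∀ s {f} → T (G s f) → ix f ≤ rounds → χ s f ≢ χ (other s) f → Recoloured f
  recoloured before present early changed = from T-recoloured (inj₁ present , early , changed)
  recoloured after  present early changed = from T-recoloured (inj₂ present , early , changed ∘ sym)

  flipped⇒failed-on-one-side : ∀ {e} → Flipped e → ∃[ s ] Failed s e × ¬ Failed (other s) e
  flipped⇒failed-on-one-side fl with T-xor fl
  ... | inj₁ (failed , ¬failed) = before , to T-failedᵇ failed , ¬failed ∘ from T-failedᵇ
  ... | inj₂ (¬failed , failed) = after  , to T-failedᵇ failed , ¬failed ∘ from T-failedᵇ

  failed-on-both-sides⇒¬flipped : ∀ {e} → (∀ s → Failed s e) → ¬ Flipped e
  failed-on-both-sides⇒¬flipped failed fl with T-xor fl
  ... | inj₁ (_ , ¬failed) = ¬failed (from T-failedᵇ (failed after))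
  ... | inj₂ (¬failed , _) = ¬failed (from T-failedᵇ (failed before))

  conflict-sym : ∀ {s e f} → T (G s e) → Conflict s e f → Conflict s f e
  conflict-sym present (_ , f≢e , same-round , (w , w∈e , w∈f) , same-colour) =
    present , f≢e ∘ sym , sym same-round , (w , w∈f , w∈e) , sym same-colour

  Stable : Pred (Edge n) 0ℓ
  Stable g = T (G before g) × T (G after g) × χ before g ≡ χ after g

  Stable? : Decidable Stable
  Stable? g = T? _ ×-dec T? _ ×-dec Maybe.≡-dec _≟_ _ _

  stable-present : ∀ {g} → Stable g → ∀ s → T (G s g)
  stable-present (present , _) before = present
  stable-present (_ , present , _) after = present

  stable-colour : ∀ {g} → Stable g → ∀ s s′ → χ s g ≡ χ s′ g
  stable-colour _ before before = refl
  stable-colour (_ , _ , same) before after = same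
  stable-colour (_ , _ , same) after before = sym same
  stable-colour _ after after = refl

  Blamed : Side → Edge n → Pred (Edge n) 0ℓ
  Blamed s f g = T (G s f) × Conflict s f g × Stable g × Flipped g

  Blamed? : ∀ s f → Decidable (Blamed s f)
  Blamed? s f g = T? _ ×-dec Conflict? s f g ×-dec Stable? g ×-dec Flipped? g

  BlamedAt : Side → Fin n → Edge n → Pred (Edge n) 0ℓ
  BlamedAt s w f g = Blamed s f g × Incident w g

  BlamedAt? : ∀ s w f → Decidable (BlamedAt s w f)
  BlamedAt? s w f g = Blamed? s f g ×-dec Dec.map T-incidentOn (T? _)

  blamed⇒failed : ∀ {s f g} → Blamed s f g → Failed s f
  blamed⇒failed (present , conflict , _) = present , inj₂ (_ , conflict)

  blamedAt-unique : ∀ {s w f g₁ g₂} → BlamedAt s w f g₁ → BlamedAt s w f g₂ → g₁ ≡ g₂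
  blamedAt-unique {s} {w} {f} {g₁} {g₂}
    ((_ , (_ , _ , round₁ , _ , colour₁) , stable₁ , flipped₁) , w∈g₁)
    ((_ , (_ , _ , round₂ , _ , colour₂) , stable₂ , _) , w∈g₂)
    with g₂ ≟ₑ g₁
  ... | yes g₂≡g₁ = sym g₂≡g₁
  ... | no g₂≢g₁ = contradiction flipped₁ (failed-on-both-sides⇒¬flipped failed)
    where
    conflict : ∀ s′ → Conflict s′ g₁ g₂
    conflict s′ =
      stable-present stable₂ s′ , g₂≢g₁ , trans round₂ (sym round₁) , (w , w∈g₁ , w∈g₂) ,
      (begin
        χ s′ g₂ ≡⟨ stable-colour stable₂ s′ s ⟩
        χ s g₂  ≡⟨ colour₂ ⟩
        χ s f   ≡⟨ colour₁ ⟨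
        χ s g₁  ≡⟨ stable-colour stable₁ s s′ ⟩
        χ s′ g₁ ∎)
      where open ≡-Reasoning
    failed : ∀ s′ → Failed s′ g₁
    failed s′ = stable-present stable₁ s′ , inj₂ (g₂ , conflict s′)

  blamed-≤2 : ∀ s f → count (does ∘ Blamed? s f) (allEdges n) ≤ 2
  blamed-≤2 s f = ≤-trans
    (count-≤-∪ (BlamedAt? s (proj₁ f) f) (BlamedAt? s (proj₂ f) f) (Blamed? s f)
      at-endpoint (allEdges n))
    (+-mono-≤ (count-≤1 (BlamedAt? s (proj₁ f) f) blamedAt-unique allEdges-unique)
              (count-≤1 (BlamedAt? s (proj₂ f) f) blamedAt-unique allEdges-unique))
    where
    at-endpoint : Blamed s f ⊆ BlamedAt s (proj₁ f) f ∪ BlamedAt s (proj₂ f) f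
    at-endpoint b@(_ , (_ , _ , _ , (_ , inj₁ refl , w∈g) , _) , _) = inj₁ (b , w∈g)
    at-endpoint b@(_ , (_ , _ , _ , (_ , inj₂ refl , w∈g) , _) , _) = inj₂ (b , w∈g)

  blamed-≡0 : ∀ {s f} → ¬ Failed s f → count (does ∘ Blamed? s f) (allEdges n) ≡ 0
  blamed-≡0 {s} {f} ¬failed =
    count-≡0 (Blamed? s f) {allEdges n} (All.tabulate λ _ → ¬failed ∘ blamed⇒failed)

  Charged : Edge n → Pred (Edge n) 0ℓ
  Charged f = (Flipped ∩ (_≡ f)) ∪ Blamed before f ∪ Blamed after f

  Charged? : ∀ f → Decidable (Charged f)
  Charged? f = (Flipped? ∩? (_≟ₑ f)) ∪? Blamed? before f ∪? Blamed? after f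

  charged-≤4 : ∀ f → count (does ∘ Charged? f) (allEdges n) ≤ 4
  charged-≤4 f = ≤-trans split (bound (toSum (Flipped? f)))
    where
    L : List (Edge n)
    L = allEdges n
    self : ℕ
    self = count (does ∘ (Flipped? ∩? (_≟ₑ f))) L
    blamed : Side → ℕ
    blamed s = count (does ∘ Blamed? s f) L

    split : count (does ∘ Charged? f) L ≤ self + (blamed before + blamed after)
    split = ≤-trans (count-∪ (Flipped? ∩? (_≟ₑ f)) (Blamed? before f ∪? Blamed? after f) L)
      (+-monoʳ-≤ self (count-∪ (Blamed? before f) (Blamed? after f) L))

    self-≤1 : self ≤ 1
    self-≤1 =
      count-≤1 (Flipped? ∩? (_≟ₑ f)) (λ { (_ , refl) (_ , refl) → refl }) allEdges-unique

    bound : Flipped f ⊎ ¬ Flipped f → self + (blamed before + blamed after) ≤ 4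
    bound (inj₂ ¬flipped) = +-mono-≤
      (≤-reflexive (count-≡0 (Flipped? ∩? (_≟ₑ f)) {L}
        (All.tabulate λ { _ (flipped , refl) → ¬flipped flipped })))
      (+-mono-≤ (blamed-≤2 before f) (blamed-≤2 after f))
    bound (inj₁ flipped) with flipped⇒failed-on-one-side flipped
    ... | before , _ , ¬failed = m≤n⇒m≤1+n
      (+-mono-≤ self-≤1 (+-mono-≤ (blamed-≤2 before f) (≤-reflexive (blamed-≡0 ¬failed))))
    ... | after , _ , ¬failed = m≤n⇒m≤1+n
      (+-mono-≤ self-≤1 (+-mono-≤ (≤-reflexive (blamed-≡0 ¬failed)) (blamed-≤2 after f)))

  Unchanged : Pred (Edge n) 0ℓ
  Unchanged e = G before e ≡ G after e

  Unchanged? : Decidable Unchanged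
  Unchanged? e = G before e Bool.≟ G after e

  unchanged-present : ∀ {g} → Unchanged g → ∀ {s} → T (G s g) → ∀ s′ → T (G s′ g)
  unchanged-present _ {before} present before = present
  unchanged-present same {before} present after = subst T same present
  unchanged-present same {after} present before = subst T (sym same) present
  unchanged-present _ {after} present after = present

  coloured-unless-failed : ∀ {s g} → (∀ s′ → T (G s′ g)) → ¬ Failed s g
    → ∃[ c ] χ s g ≡ just c
  coloured-unless-failed {s} {g} present ¬failed with χ s g in colour
  ... | just c  = c , refl
  ... | nothing = contradiction (present s , inj₁ refl) ¬failed

  lost-conflict : ∀ {g} → Flipped g → Unchanged g → ¬ Recoloured g
    → ∃[ s ] ∃[ f ] ∃[ c ] Stable g × χ s g ≡ just c × Conflict s g f × ¬ Conflict (other s) g f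
  lost-conflict {g} flipped unchanged ¬recoloured with flipped⇒failed-on-one-side flipped
  ... | s , (present , cause) , ¬failed′ =
    let (f , conflict) =
          Sum.fromInj₂ (λ uncoloured → contradiction (trans (sym uncoloured) coloured) λ ()) cause
    in s , f , proj₁ colour′ , stable , coloured , conflict ,
       λ conflict′ → ¬failed′ (everywhere (other s) , inj₂ (f , conflict′))
    where
    everywhere : ∀ s′ → T (G s′ g)
    everywhere = unchanged-present unchanged present
    colour′ : ∃[ c ] χ (other s) g ≡ just c
    colour′ = coloured-unless-failed everywhere ¬failed′
    early : ix g ≤ rounds
    early = proj₂ (supported (other s) g (proj₂ colour′))
    stable : Stable g
    stable = everywhere before , everywhere after , decidable-stable (Maybe.≡-dec _≟_ _ _)
      (¬recoloured ∘ recoloured before (everywhere before) early)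
    coloured : χ s g ≡ just (proj₁ colour′)
    coloured = trans (stable-colour stable s (other s)) (proj₂ colour′)

  lost-conflict⇒recoloured : ∀ {s g f c} → Stable g → χ s g ≡ just c
    → Conflict s g f → ¬ Conflict (other s) g f → Recoloured f
  lost-conflict⇒recoloured {s} {g} {f} {c} stable coloured
    (present , f≢g , same-round , adjacent , same-colour) ¬conflict′ =
    recoloured s present (proj₂ (supported s f coloured-f)) λ kept →
      ¬conflict′ (proj₁ (supported (other s) f (trans (sym kept) coloured-f)) , f≢g , same-round ,
        adjacent , trans (sym kept) (trans same-colour (stable-colour stable s (other s))))
    where
    coloured-f : χ s f ≡ just c
    coloured-f = trans same-colour coloured

  blamed⇒charged : ∀ s {f g} → Blamed s f g → Charged f g
  blamed⇒charged before = inj₂ ∘ inj₁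
  blamed⇒charged after  = inj₂ ∘ inj₂

  recoloured-charger : ∀ {g} → (Flipped ∩ Unchanged) g
    → ∃[ f ] f ∈ allEdges n × Recoloured f × Charged f g
  recoloured-charger {g} (flipped , unchanged) with Recoloured? g
  ... | yes recoloured-g = g , allEdges-complete g , recoloured-g , inj₁ (flipped , refl)
  ... | no ¬recoloured-g with lost-conflict flipped unchanged ¬recoloured-g
  ...   | s , f , _ , stable , coloured , conflict , ¬conflict′ =
    f , allEdges-complete f , lost-conflict⇒recoloured stable coloured conflict ¬conflict′ ,
    blamed⇒charged s
      (proj₁ conflict , conflict-sym (stable-present stable s) conflict , stable , flipped)

  flipped-≤ : DifferInAtMostOneEdge (G before) (G after)
    → count (does ∘ Flipped?) (allEdges n) ≤ 4 * count (does ∘ Recoloured?) (allEdges n) + 1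
  flipped-≤ one-edge = begin
    count (does ∘ Flipped?) L
      ≤⟨ count-≤-∪ (∁? Unchanged?) (Flipped? ∩? Unchanged?) Flipped? changed-or-not L ⟩
    count (does ∘ ∁? Unchanged?) L + count (does ∘ (Flipped? ∩? Unchanged?)) L
      ≤⟨ +-mono-≤ (count-≤1 (∁? Unchanged?) one-edge allEdges-unique)
                  (count-≤-charged Recoloured? Charged? L (λ {f} _ → charged-≤4 f)
                     (Flipped? ∩? Unchanged?) L recoloured-charger) ⟩
    1 + #recoloured * 4   ≡⟨ +-comm 1 _ ⟩
    #recoloured * 4 + 1   ≡⟨ cong (_+ 1) (*-comm #recoloured 4) ⟩
    4 * #recoloured + 1   ∎
    where
    open ≤-Reasoning
    L : List (Edge n)
    L = allEdges n
    #recoloured : ℕ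
    #recoloured = count (does ∘ Recoloured?) L
    changed-or-not : Flipped ⊆ ∁ Unchanged ∪ (Flipped ∩ Unchanged)
    changed-or-not {g} flipped = Sum.swap (Sum.map₁ (flipped ,_) (toSum (Unchanged? g)))

lemmaB4 : {n η K : ℕ} (T : ℕ) (C : Fin η → List ℕ)
    → (∀ (j j′ : Fin η) (c : ℕ) → j ≢ j′ → c ∈ C j → c ∉ C j′)
    → (jx : Edge n → Fin η) (ix : Edge n → ℕ)
    → (∀ e → (1 ≤ ix e) × (ix e ≤ T + 1))
    → (cx : Edge n → Vec ℕ K)
    → (us : List (Update n)) → Valid emptyGraph us
    → (t : ℕ) → 1 ≤ t → t ≤ length us
    → Changes.sizeB T C jx ix cx us t ≤ 4 * Changes.sizeA T C jx ix cx us t + 1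
lemmaB4 {n} rounds C _ jx ix _ cx us _ (suc t) _ _ =
  Recolouring.flipped-≤ rounds ix snapshot colouring supported
    (foldl-applyU-step-differs-in-one-edge emptyGraph us t)
  where
  snapshot : Side → Graph n
  snapshot before = graphAt us t
  snapshot after  = graphAt us (suc t)

  colouring : Side → Edge n → Maybe ℕ
  colouring s = Coloring.χ rounds C jx ix cx (snapshot s)

  supported : ∀ s e {c} → colouring s e ≡ just c → T (snapshot s e) × ix e ≤ rounds
  supported s = χ-supported rounds C jx ix cx (snapshot s)
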